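{- Let $q\ge 2$ be an integer and let $\mathcal{R}$ be a corner-intersecting family of axis-parallel rectangles in general position containing no $q+1$ pairwise intersecting rectangles. Then the arrangement graph $A_\mathcal{R}$ satisfies $|V(A_\mathcal{R})|\le 4q\cdot|\mathcal{R}|$.
   Context: An axis-parallel rectangle is $R=(X,Y)$ with $X,Y$ closed bounded intervals; its boundary is the set of its points having extreme $x$- or $y$-coordinate. General position: all intervals in the specifications have pairwise distinct endpoints. Two rectangles intersect if they share a point. A family is corner-intersecting if whenever two of its rectangles intersect, one contains one or two corners of the other and neither contains the other. A joint is a point where the boundaries of two distinct rectangles of $\mathcal{R}$ intersect. The arrangement graph $A_\mathcal{R}$ has the joints as vertices, and $\{u,v\}$ is an edge iff $u,v$ are joints on the boundary of some rectangle with no other joint on that boundary between them. -}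

module Defs where

open import Level using (Level; _⊔_)
open import Data.Nat using (ℕ; _≤_)
open import Data.Fin using (Fin)
open import Data.Bool using (Bool; true; false)
open import Data.Product using (Σ; ∃; _×_; _,_)
open import Data.Sum using (_⊎_)
open import Data.List using (List; length)
open import Data.List.Relation.Unary.All using (All)
open import Data.List.Relation.Unary.AllPairs using (AllPairs)
open import Relation.Nullary using (¬_)
open import Relation.Binary.PropositionalEquality using (_≡_; _≢_)
open import Relation.Binary.Bundles using (StrictTotalOrder)

-- Plane geometry over an arbitrary strict total order of coordinates
-- (this covers ℝ; only the order of coordinates matters).
module Geom {a ℓ₁ ℓ₂ : Level} (O : StrictTotalOrder a ℓ₁ ℓ₂) where
  open StrictTotalOrder O renaming (Carrier to C)

  _≤ᶜ_ : C → C → Set (ℓ₁ ⊔ ℓ₂)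
  x ≤ᶜ y = (x < y) ⊎ (x ≈ y)

  record Interval : Set (a ⊔ ℓ₁ ⊔ ℓ₂) where
    constructor [_,_]⟨_⟩
    field
      lo hi : C
      lo≤hi : lo ≤ᶜ hi
  open Interval public

  _∈ᴵ_ : C → Interval → Set (ℓ₁ ⊔ ℓ₂)
  x ∈ᴵ I = (lo I ≤ᶜ x) × (x ≤ᶜ hi I)

  endpoint : Interval → Bool → C
  endpoint I false = lo I
  endpoint I true  = hi I

  record Rect : Set (a ⊔ ℓ₁ ⊔ ℓ₂) where
    constructor rect
    field
      X Y : Interval
  open Rect public

  Point : Set a
  Point = C × C

  _≈ᵖ_ : Point → Point → Set ℓ₁
  (x , y) ≈ᵖ (x' , y') = (x ≈ x') × (y ≈ y')

  DistinctPts : Point → Point → Set ℓ₁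
  DistinctPts p p' = ¬ (p ≈ᵖ p')

  _∈ᴿ_ : Point → Rect → Set (ℓ₁ ⊔ ℓ₂)
  (x , y) ∈ᴿ R = (x ∈ᴵ X R) × (y ∈ᴵ Y R)

  _∈∂_ : Point → Rect → Set (ℓ₁ ⊔ ℓ₂)
  (x , y) ∈∂ R = ((x , y) ∈ᴿ R) ×
    ((x ≈ lo (X R)) ⊎ (x ≈ hi (X R)) ⊎ (y ≈ lo (Y R)) ⊎ (y ≈ hi (Y R)))

  Corner : Set
  Corner = Bool × Bool

  corner : Rect → Corner → Point
  corner R (bx , by) = endpoint (X R) bx , endpoint (Y R) by

  Intersect : Rect → Rect → Set (a ⊔ ℓ₁ ⊔ ℓ₂)
  Intersect R S = ∃ λ p → (p ∈ᴿ R) × (p ∈ᴿ S)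

  Contains : Rect → Rect → Set (a ⊔ ℓ₁ ⊔ ℓ₂)
  Contains R S = ∀ p → p ∈ᴿ S → p ∈ᴿ R

  ContainsOneOrTwoCorners : Rect → Rect → Set (ℓ₁ ⊔ ℓ₂)
  ContainsOneOrTwoCorners R S =
    (∃ λ c → corner S c ∈ᴿ R) ×
    ¬ (Σ Corner λ c₁ → Σ Corner λ c₂ → Σ Corner λ c₃ →
         (c₁ ≢ c₂) × (c₁ ≢ c₃) × (c₂ ≢ c₃) ×
         (corner S c₁ ∈ᴿ R) × (corner S c₂ ∈ᴿ R) × (corner S c₃ ∈ᴿ R))

  Family : ℕ → Set (a ⊔ ℓ₁ ⊔ ℓ₂)
  Family n = Fin n → Rect

  GeneralPosition : ∀ {n} → Family n → Set ℓ₁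
  GeneralPosition {n} ℛ =
    (∀ (i j : Fin n) (b b' : Bool) →
       endpoint (X (ℛ i)) b ≈ endpoint (X (ℛ j)) b' → (i ≡ j) × (b ≡ b')) ×
    (∀ (i j : Fin n) (b b' : Bool) →
       endpoint (Y (ℛ i)) b ≈ endpoint (Y (ℛ j)) b' → (i ≡ j) × (b ≡ b'))

  CornerIntersecting : ∀ {n} → Family n → Set (a ⊔ ℓ₁ ⊔ ℓ₂)
  CornerIntersecting {n} ℛ = ∀ (i j : Fin n) → i ≢ j → Intersect (ℛ i) (ℛ j) →
    (ContainsOneOrTwoCorners (ℛ i) (ℛ j) ⊎ ContainsOneOrTwoCorners (ℛ j) (ℛ i)) ×
    ¬ Contains (ℛ i) (ℛ j) × ¬ Contains (ℛ j) (ℛ i)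

  NoPairwiseIntersecting : ∀ {n} → ℕ → Family n → Set (a ⊔ ℓ₁ ⊔ ℓ₂)
  NoPairwiseIntersecting {n} k ℛ =
    (f : Fin k → Fin n) →
    (∀ u v → f u ≡ f v → u ≡ v) →
    ¬ (∀ u v → u ≢ v → Intersect (ℛ (f u)) (ℛ (f v)))

  Joint : ∀ {n} → Family n → Point → Set (ℓ₁ ⊔ ℓ₂)
  Joint {n} ℛ p = Σ (Fin n) λ i → Σ (Fin n) λ j →
    (i ≢ j) × (p ∈∂ ℛ i) × (p ∈∂ ℛ j)

  -- V(A_ℛ) has at most N elements: every duplicate-free finite list of
  -- vertices (joints) has length at most N
  VerticesAtMost : ∀ {n} → Family n → ℕ → Set (a ⊔ ℓ₁ ⊔ ℓ₂)
  VerticesAtMost ℛ N = (ps : List Point) → AllPairs DistinctPts ps →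
    All (Joint ℛ) ps → length ps ≤ N

-- By general position, a joint p is where a vertical side of some rectangle R
-- meets a horizontal side of another rectangle S.  Follow the vertical side of R
-- from p into S, and the horizontal side of S from p into R: corner-intersection
-- and general position force one of them to end, at a corner of its rectangle,
-- inside the other rectangle.  Charging p to that (corner, rectangle) pair,
-- preferring the vertical side, is injective; and as the rectangles containing a
-- corner pairwise intersect, each of the 4|ℛ| corners is charged at most q times.
module Submission where

open import Defs
open import Level using (Level; _⊔_)
open import Function using (_∘_; id)
open import Data.Bool using (Bool; true; false; not; _≟_)
open import Data.Empty using (⊥-elim)
open import Data.Fin as Fin using (Fin; inject≤)
open import Data.Fin.Properties using (inject≤-injective)
open import Data.List using (List; []; _∷_; length; map; filter; lookup; allFin)
open import Data.List.Properties using (length-map; length-tabulate)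
open import Data.List.Membership.Propositional using (_∈_)
open import Data.List.Membership.Propositional.Properties using (∈-lookup; ∈-allFin)
open import Data.List.Relation.Unary.All as All using (All; []; _∷_)
import Data.List.Relation.Unary.All.Properties as Allₚ
open import Data.List.Relation.Unary.Any using (here; there)
open import Data.List.Relation.Unary.AllPairs using (AllPairs; []; _∷_)
open import Data.List.Relation.Unary.Unique.Propositional using (Unique)
import Data.List.Relation.Unary.Unique.Propositional.Properties as Uniqueₚ
open import Data.Nat using (ℕ; suc; _+_; _*_; _≤_; z≤n; s≤s⁻¹; _≤?_)
open import Data.Nat.Properties using (+-suc; +-mono-≤; *-comm; ≰⇒>; module ≤-Reasoning)
open import Data.Product using (Σ; ∃; _×_; _,_; proj₁; proj₂; uncurry)
import Data.Product.Properties as Productₚ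
open import Data.Sum using (_⊎_; inj₁; inj₂)
open import Relation.Nullary using (¬_; Dec; yes; no; does)
open import Relation.Nullary.Decidable using (_×-dec_)
open import Relation.Unary using (Pred; Decidable)
open import Relation.Unary.Properties using (∁?)
open import Relation.Binary using (Rel; DecidableEquality)
open import Relation.Binary.Bundles using (StrictTotalOrder)
open import Relation.Binary.PropositionalEquality using (_≡_; _≢_; refl; sym; trans; cong; subst)

module _ {a p} {A : Set a} {P : Pred A p} (P? : Decidable P) where

  length-filter+filter-∁ : ∀ xs → length xs ≡ length (filter P? xs) + length (filter (∁? P?) xs)
  length-filter+filter-∁ [] = refl
  length-filter+filter-∁ (x ∷ xs) with ih ← length-filter+filter-∁ xs | does (P? x)
  ... | true  = cong suc ih
  ... | false = trans (cong suc ih) (sym (+-suc _ _))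

module _ {a} {A : Set a} where

  Unique-lookup-injective : ∀ {xs : List A} → Unique xs → ∀ {i j} → lookup xs i ≡ lookup xs j → i ≡ j
  Unique-lookup-injective (_ ∷ _)     {Fin.zero}  {Fin.zero}  _  = refl
  Unique-lookup-injective (x∉ ∷ _)    {Fin.zero}  {Fin.suc j} eq = ⊥-elim (All.lookup x∉ (∈-lookup j) eq)
  Unique-lookup-injective (x∉ ∷ _)    {Fin.suc i} {Fin.zero}  eq = ⊥-elim (All.lookup x∉ (∈-lookup i) (sym eq))
  Unique-lookup-injective (_ ∷ xs!)   {Fin.suc i} {Fin.suc j} eq = cong Fin.suc (Unique-lookup-injective xs! eq)

module _ {a b} {A : Set a} {B : Set b} where

  Unique-map-proj₂ : ∀ {x : A} {ys : List (A × B)} → All ((_≡ x) ∘ proj₁) ys → Unique ys →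
    Unique (map proj₂ ys)
  Unique-map-proj₂ [] [] = []
  Unique-map-proj₂ {x} {y ∷ _} (y≡x ∷ ≡x) (y∉ ∷ ys!) =
    Allₚ.map⁺ (All.zipWith distinct (≡x , y∉)) ∷ Unique-map-proj₂ ≡x ys!
    where
    distinct : ∀ {z} → proj₁ z ≡ x × y ≢ z → proj₂ y ≢ proj₂ z
    distinct (z≡x , y≢z) eq = y≢z (Productₚ.×-≡,≡→≡ (trans y≡x (sym z≡x) , eq))

module _ {a p b r} {A : Set a} {P : Pred A p} {B : Set b} {R : Rel A r} {f : ∀ {x} → P x → B}
         (f-injective : ∀ {x y} (px : P x) (py : P y) → f px ≡ f py → R x y) where

  private
    reduce-∉ : ∀ {x ys} (px : P x) (pys : All P ys) → All (¬_ ∘ R x) ys → All (f px ≢_) (All.reduce f pys)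
    reduce-∉ px [] [] = []
    reduce-∉ px (py ∷ pys) (¬Rxy ∷ ¬Rx) = (¬Rxy ∘ f-injective px py) ∷ reduce-∉ px pys ¬Rx

  Unique-reduce : ∀ {xs} (pxs : All P xs) → AllPairs (λ x y → ¬ R x y) xs → Unique (All.reduce f pxs)
  Unique-reduce [] [] = []
  Unique-reduce (px ∷ pxs) (¬Rx ∷ xs!) = reduce-∉ px pxs ¬Rx ∷ Unique-reduce pxs xs!

module _ {a p b} {A : Set a} {P : Pred A p} {B : Set b} (f : ∀ {x} → P x → B) where

  length-reduce : ∀ {xs} (pxs : All P xs) → length (All.reduce f pxs) ≡ length xs
  length-reduce [] = refl
  length-reduce (_ ∷ pxs) = cong suc (length-reduce pxs)

  All-reduce : ∀ {q} {Q : Pred B q} → (∀ {x} (px : P x) → Q (f px)) →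
    ∀ {xs} (pxs : All P xs) → All Q (All.reduce f pxs)
  All-reduce Qf [] = []
  All-reduce Qf (px ∷ pxs) = Qf px ∷ All-reduce Qf pxs

module _ {a b ℓ} {A : Set a} {B : Set b} (_≟_ : DecidableEquality A) (Q : A → B → Set ℓ) {m : ℕ}
         (fibre-≤ : ∀ x (ys : List B) → Unique ys → All (Q x) ys → length ys ≤ m) where

  length-≤-fibres : ∀ (xs : List A) {ps : List (A × B)} → Unique ps → All (uncurry Q) ps →
    All ((_∈ xs) ∘ proj₁) ps → length ps ≤ length xs * m
  length-≤-fibres [] {[]}    _ _ _ = z≤n
  length-≤-fibres [] {_ ∷ _} _ _ (() ∷ _)
  length-≤-fibres (x ∷ xs) {ps} ps! Qps ∈ps = begin
      length ps                                               ≡⟨ length-filter+filter-∁ over-x? ps ⟩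
      length (filter over-x? ps) + length (filter (∁? over-x?) ps) ≤⟨ +-mono-≤ fibre rest ⟩
      m + length xs * m                                       ∎
    where
    open ≤-Reasoning
    over-x? : Decidable ((_≡ x) ∘ proj₁)
    over-x? q = proj₁ q ≟ x

    fibre : length (filter over-x? ps) ≤ m
    fibre = subst (_≤ m) (length-map proj₂ (filter over-x? ps))
      (fibre-≤ x _ (Unique-map-proj₂ ≡x (Uniqueₚ.filter⁺ over-x? ps!))
        (Allₚ.map⁺ (All.zipWith (λ (q≡x , Qq) → subst (λ z → Q z _) q≡x Qq)
                                (≡x , Allₚ.filter⁺ over-x? Qps))))
      where ≡x = Allₚ.all-filter over-x? ps

    ∈-tail : ∀ {q : A × B} → proj₁ q ∈ x ∷ xs × proj₁ q ≢ x → proj₁ q ∈ xs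
    ∈-tail (here q≡x , q≢x) = ⊥-elim (q≢x q≡x)
    ∈-tail (there ∈xs , _)  = ∈xs

    rest : length (filter (∁? over-x?) ps) ≤ length xs * m
    rest = length-≤-fibres xs (Uniqueₚ.filter⁺ (∁? over-x?) ps!) (Allₚ.filter⁺ (∁? over-x?) Qps)
      (All.zipWith (λ {q} → ∈-tail {q})
                   (Allₚ.filter⁺ (∁? over-x?) ∈ps , Allₚ.all-filter (∁? over-x?) ps))

module Rectangles {a ℓ₁ ℓ₂ : Level} (O : StrictTotalOrder a ℓ₁ ℓ₂) where
  open StrictTotalOrder O using (_≈_; module Eq)
  open import Relation.Binary.Properties.StrictTotalOrder O
    using (antisym; ≤-respˡ-≈; ≤-respʳ-≈) renaming (_≤?_ to _≤ᶜ?_)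
  open Geom O

  _∈ᴵ?_ : ∀ x I → Dec (x ∈ᴵ I)
  x ∈ᴵ? I = (lo I ≤ᶜ? x) ×-dec (x ≤ᶜ? hi I)

  ∈ᴵ-resp-≈ : ∀ {x y I} → x ≈ y → x ∈ᴵ I → y ∈ᴵ I
  ∈ᴵ-resp-≈ x≈y (lo≤x , x≤hi) = ≤-respʳ-≈ x≈y lo≤x , ≤-respˡ-≈ x≈y x≤hi

  ∈ᴿ-resp-≈ᵖ : ∀ {p q R} → p ≈ᵖ q → p ∈ᴿ R → q ∈ᴿ R
  ∈ᴿ-resp-≈ᵖ {_ , _} {_ , _} {R} (x≈ , y≈) (x∈ , y∈) =
    ∈ᴵ-resp-≈ {I = X R} x≈ x∈ , ∈ᴵ-resp-≈ {I = Y R} y≈ y∈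

  ≈ᵖ-trans : ∀ {p q r} → p ≈ᵖ q → q ≈ᵖ r → p ≈ᵖ r
  ≈ᵖ-trans (x≈ , y≈) (x≈′ , y≈′) = Eq.trans x≈ x≈′ , Eq.trans y≈ y≈′

  ≈ᵖ-sym : ∀ {p q} → p ≈ᵖ q → q ≈ᵖ p
  ≈ᵖ-sym (x≈ , y≈) = Eq.sym x≈ , Eq.sym y≈

  ∈ᴵ-opposite-endpoint : ∀ {I J} b c → ¬ endpoint I b ≈ endpoint J b →
    endpoint I b ∈ᴵ J → endpoint J c ∈ᴵ I → endpoint J (not b) ∈ᴵ I
  ∈ᴵ-opposite-endpoint false false ≉ (lo≤ , _) (lo≤′ , _) = ⊥-elim (≉ (antisym lo≤′ lo≤))
  ∈ᴵ-opposite-endpoint false true  _ _ hi∈ = hi∈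
  ∈ᴵ-opposite-endpoint true  false _ _ lo∈ = lo∈
  ∈ᴵ-opposite-endpoint true  true  ≉ (_ , ≤hi) (_ , ≤hi′) = ⊥-elim (≉ (antisym ≤hi ≤hi′))

  ∈∂⇒on-side : ∀ {x y R} → (x , y) ∈∂ R →
    (∃ λ b → x ≈ endpoint (X R) b) ⊎ (∃ λ b → y ≈ endpoint (Y R) b)
  ∈∂⇒on-side (_ , inj₁ x≈)               = inj₁ (false , x≈)
  ∈∂⇒on-side (_ , inj₂ (inj₁ x≈))        = inj₁ (true , x≈)
  ∈∂⇒on-side (_ , inj₂ (inj₂ (inj₁ y≈))) = inj₂ (false , y≈)
  ∈∂⇒on-side (_ , inj₂ (inj₂ (inj₂ y≈))) = inj₂ (true , y≈)

  corners : List Corner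
  corners = (false , false) ∷ (false , true) ∷ (true , false) ∷ (true , true) ∷ []

  ∈-corners : ∀ c → c ∈ corners
  ∈-corners (false , false) = here refl
  ∈-corners (false , true)  = there (here refl)
  ∈-corners (true , false)  = there (there (here refl))
  ∈-corners (true , true)   = there (there (there (here refl)))

  module _ {n} (ℛ : Family n) where

    ≤-through-point : ∀ q → NoPairwiseIntersecting (suc q) ℛ → ∀ p (js : List (Fin n)) →
      Unique js → All (λ j → p ∈ᴿ ℛ j) js → length js ≤ q
    ≤-through-point q noClique p js js! p∈ with suc q ≤? length js
    ... | no  q≱ = s≤s⁻¹ (≰⇒> q≱)
    ... | yes q< = ⊥-elim (noClique pick pick-injective pairwise)
      where
      pick : Fin (suc q) → Fin n
      pick k = lookup js (inject≤ k q<)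
      pick-injective : ∀ u v → pick u ≡ pick v → u ≡ v
      pick-injective u v eq = inject≤-injective q< q< u v (Unique-lookup-injective js! eq)
      pairwise : ∀ u v → u ≢ v → Intersect (ℛ (pick u)) (ℛ (pick v))
      pairwise u v _ = p , All.lookup p∈ (∈-lookup _) , All.lookup p∈ (∈-lookup _)

    meet : Fin n → Fin n → Bool → Bool → Point
    meet i j bx by = endpoint (X (ℛ i)) bx , endpoint (Y (ℛ j)) by

    record Crossing (p : Point) : Set (ℓ₁ ⊔ ℓ₂) where
      constructor crossing
      field
        vert horiz : Fin n
        bx by : Bool
        vert≢horiz : vert ≢ horiz
        ≈meet : p ≈ᵖ meet vert horiz bx by
        meet∈vert : meet vert horiz bx by ∈ᴿ ℛ vert
        meet∈horiz : meet vert horiz bx by ∈ᴿ ℛ horiz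

    CornerIncidence : Set
    CornerIncidence = Fin n × Corner × Fin n

    Inside : CornerIncidence → Set (ℓ₁ ⊔ ℓ₂)
    Inside (k , c , l) = corner (ℛ k) c ∈ᴿ ℛ l

    -- p ↦ (k , c , l): p is where a side of ℛ k ending at its corner c meets a side of ℛ l.
    -- The side conditions of the two constructors are complementary, so no pair is
    -- charged by a vertical and a horizontal meeting point at once.
    data _↦_ (p : Point) : CornerIncidence → Set (ℓ₁ ⊔ ℓ₂) where
      vertical : ∀ {k cx cy l} → p ≈ᵖ meet k l cx (not cy) →
        endpoint (Y (ℛ l)) (not cy) ∈ᴵ Y (ℛ k) → p ↦ (k , (cx , cy) , l)
      horizontal : ∀ {k cx cy l} → p ≈ᵖ meet l k (not cx) cy →
        ¬ endpoint (Y (ℛ l)) (not cy) ∈ᴵ Y (ℛ k) → p ↦ (k , (cx , cy) , l)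

    ↦-injective : ∀ {p p′ t} → p ↦ t → p′ ↦ t → p ≈ᵖ p′
    ↦-injective (vertical p≈ _)     (vertical p′≈ _)     = ≈ᵖ-trans p≈ (≈ᵖ-sym p′≈)
    ↦-injective (horizontal p≈ _)   (horizontal p′≈ _)   = ≈ᵖ-trans p≈ (≈ᵖ-sym p′≈)
    ↦-injective (vertical _ y∈)     (horizontal _ y∉)    = ⊥-elim (y∉ y∈)
    ↦-injective (horizontal _ y∉)   (vertical _ y∈)      = ⊥-elim (y∉ y∈)

    -- `not (not b)` reduces to b only once b is a constructor.
    ↦-vertical : ∀ {p k l} cx cy → p ≈ᵖ meet k l cx cy →
      endpoint (Y (ℛ l)) cy ∈ᴵ Y (ℛ k) → p ↦ (k , (cx , not cy) , l)
    ↦-vertical _ false = vertical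
    ↦-vertical _ true  = vertical

    ↦-horizontal : ∀ {p k l} cx cy → p ≈ᵖ meet l k cx cy →
      ¬ endpoint (Y (ℛ l)) (not cy) ∈ᴵ Y (ℛ k) → p ↦ (k , (not cx , cy) , l)
    ↦-horizontal false _ = horizontal
    ↦-horizontal true  _ = horizontal

    incidences-≤ : ∀ q → NoPairwiseIntersecting (suc q) ℛ → ∀ (ts : List CornerIncidence) →
      Unique ts → All Inside ts → length ts ≤ n * (4 * q)
    incidences-≤ q noClique ts ts! inside =
      subst (λ k → length ts ≤ k * (4 * q)) (length-tabulate {A = Fin n} id)
      (length-≤-fibres Fin._≟_ (λ k (c , l) → corner (ℛ k) c ∈ᴿ ℛ l) corner-fibre
        (allFin n) ts! inside (All.universal (λ t → ∈-allFin (proj₁ t)) ts))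
      where
      corner-fibre : ∀ k cls → Unique cls → All (λ (c , l) → corner (ℛ k) c ∈ᴿ ℛ l) cls →
        length cls ≤ length corners * q
      corner-fibre k cls cls! inside′ =
        length-≤-fibres (Productₚ.≡-dec _≟_ _≟_) (λ c l → corner (ℛ k) c ∈ᴿ ℛ l)
          (λ c → ≤-through-point q noClique (corner (ℛ k) c))
          corners cls! inside′ (All.universal (λ cl → ∈-corners (proj₁ cl)) cls)

    module _ (gp : GeneralPosition ℛ) where

      X-endpoints-distinct : ∀ {i j} → i ≢ j → ∀ b b′ → ¬ endpoint (X (ℛ i)) b ≈ endpoint (X (ℛ j)) b′
      X-endpoints-distinct i≢j b b′ = i≢j ∘ proj₁ ∘ proj₁ gp _ _ b b′

      Y-endpoints-distinct : ∀ {i j} → i ≢ j → ∀ b b′ → ¬ endpoint (Y (ℛ i)) b ≈ endpoint (Y (ℛ j)) b′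
      Y-endpoints-distinct i≢j b b′ = i≢j ∘ proj₁ ∘ proj₂ gp _ _ b b′

      joint⇒crossing : ∀ {p} → Joint ℛ p → Crossing p
      joint⇒crossing {x , y} (i , j , i≢j , ∂i@(p∈i , _) , ∂j@(p∈j , _)) with ∈∂⇒on-side ∂i | ∈∂⇒on-side ∂j
      ... | inj₁ (bx , x≈) | inj₁ (bx′ , x≈′) =
        ⊥-elim (X-endpoints-distinct i≢j bx bx′ (Eq.trans (Eq.sym x≈) x≈′))
      ... | inj₁ (bx , x≈) | inj₂ (by , y≈) =
        crossing i j bx by i≢j (x≈ , y≈)
          (∈ᴿ-resp-≈ᵖ {R = ℛ i} (x≈ , y≈) p∈i) (∈ᴿ-resp-≈ᵖ {R = ℛ j} (x≈ , y≈) p∈j)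
      ... | inj₂ (by , y≈) | inj₁ (bx , x≈) =
        crossing j i bx by (i≢j ∘ sym) (x≈ , y≈)
          (∈ᴿ-resp-≈ᵖ {R = ℛ j} (x≈ , y≈) p∈j) (∈ᴿ-resp-≈ᵖ {R = ℛ i} (x≈ , y≈) p∈i)
      ... | inj₂ (by , y≈) | inj₂ (by′ , y≈′) =
        ⊥-elim (Y-endpoints-distinct i≢j by by′ (Eq.trans (Eq.sym y≈) y≈′))

      module _ (ci : CornerIntersecting ℛ) where

        crossing-exits : ∀ {p} (c : Crossing p) → let open Crossing c in
          endpoint (Y (ℛ vert)) (not by) ∈ᴵ Y (ℛ horiz) ⊎ endpoint (X (ℛ horiz)) (not bx) ∈ᴵ X (ℛ vert)
        crossing-exits (crossing i j bx by i≢j _ m∈i m∈j) with proj₁ (ci i j i≢j (meet i j bx by , m∈i , m∈j))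
        ... | inj₁ (((cx , _) , c∈i) , _) =
          inj₂ (∈ᴵ-opposite-endpoint bx cx (X-endpoints-distinct i≢j bx bx) (proj₁ m∈j) (proj₁ c∈i))
        ... | inj₂ (((_ , cy) , c∈j) , _) =
          inj₁ (∈ᴵ-opposite-endpoint by cy (Y-endpoints-distinct (i≢j ∘ sym) by by) (proj₂ m∈i) (proj₂ c∈j))

        charge : ∀ {p} → Crossing p → Σ CornerIncidence λ t → p ↦ t × Inside t
        charge c@(crossing i j bx by _ p≈ m∈i m∈j) with endpoint (Y (ℛ i)) (not by) ∈ᴵ? Y (ℛ j)
        ... | yes y∈ = (i , (bx , not by) , j) , ↦-vertical bx by p≈ (proj₂ m∈i) , (proj₁ m∈j , y∈)
        ... | no  y∉ = (j , (not bx , by) , i) , ↦-horizontal bx by p≈ y∉ , (x∈ , proj₂ m∈i)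
          where
          x∈ : endpoint (X (ℛ j)) (not bx) ∈ᴵ X (ℛ i)
          x∈ with crossing-exits c
          ... | inj₁ y∈ = ⊥-elim (y∉ y∈)
          ... | inj₂ x∈ = x∈

        chargeOf : ∀ {p} → Joint ℛ p → CornerIncidence
        chargeOf = proj₁ ∘ charge ∘ joint⇒crossing

        chargeOf-↦ : ∀ {p} (jp : Joint ℛ p) → p ↦ chargeOf jp
        chargeOf-↦ = proj₁ ∘ proj₂ ∘ charge ∘ joint⇒crossing

        chargeOf-Inside : ∀ {p} (jp : Joint ℛ p) → Inside (chargeOf jp)
        chargeOf-Inside = proj₂ ∘ proj₂ ∘ charge ∘ joint⇒crossing

        chargeOf-injective : ∀ {p p′} (jp : Joint ℛ p) (jp′ : Joint ℛ p′) →
          chargeOf jp ≡ chargeOf jp′ → p ≈ᵖ p′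
        chargeOf-injective {p′ = p′} jp jp′ eq =
          ↦-injective (chargeOf-↦ jp) (subst (p′ ↦_) (sym eq) (chargeOf-↦ jp′))

        vertices-≤ : ∀ q → NoPairwiseIntersecting (suc q) ℛ → VerticesAtMost ℛ (n * (4 * q))
        vertices-≤ q noClique ps ps! joints = begin
          length ps                          ≡⟨ sym (length-reduce chargeOf joints) ⟩
          length (All.reduce chargeOf joints) ≤⟨ incidences-≤ q noClique _
                                                   (Unique-reduce chargeOf-injective joints ps!)
                                                   (All-reduce chargeOf chargeOf-Inside joints) ⟩
          n * (4 * q)                        ∎
          where open ≤-Reasoning

-- The bound holds for every q.
lemma3 : ∀ {a ℓ₁ ℓ₂ : Level} (O : StrictTotalOrder a ℓ₁ ℓ₂) (q n : ℕ) →
    2 ≤ q → (ℛ : Geom.Family O n) →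
    Geom.GeneralPosition O ℛ → Geom.CornerIntersecting O ℛ →
    Geom.NoPairwiseIntersecting O (suc q) ℛ →
    Geom.VerticesAtMost O ℛ (4 * q * n)
lemma3 O q n _ ℛ gp ci noClique =
  subst (Geom.VerticesAtMost O ℛ) (*-comm n (4 * q)) (Rectangles.vertices-≤ O ℛ gp ci q noClique)
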